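{- Let $n\ge1$ and let $\tau=(\mathfrak{F},\mathfrak{T},\mathfrak{G})$ be a forest-tree-forest triple with $n$ leaves, labelling a face of $\mathcal{F}^n$. Then: (1) the minimal vertex of this face (the vertex whose coordinates are coordinatewise $\le$ those of every vertex of the face) is the vertex labelled by the triple $V_{\min}$ obtained from $\tau$ by moving all branches of $\mathfrak{T}$ (if $\mathfrak{T}$ is nonempty) to the left forest as a new rightmost tree, and then pushing apart at all mid-branch spaces; (2) the maximal vertex of this face (coordinatewise $\ge$ every vertex of the face) is the vertex labelled by the triple $V_{\max}$ obtained from $\tau$ by moving all branches of $\mathfrak{T}$ (if nonempty) to the right forest as a new leftmost tree, and then merging at all mid-branch spaces.
   Context: A short forest is a (possibly empty) sequence of nonempty planar rooted trees of depth 2; the edges at the root are branches and the outer edges (each branch carries at least one) are leaves. A forest-tree-forest triple $(\mathfrak{F},\mathfrak{T},\mathfrak{G})$ consists of a left short forest $\mathfrak{F}$, a middle planar tree $\mathfrak{T}$ of depth 2 (possibly empty), and a right short forest $\mathfrak{G}$; its leaves are all leaves of all these trees, in planar order. A mid-branch space is a pair of neighbouring branches of the same tree. The dimension of the triple is the number of mid-branch spaces, plus $1$ if $\mathfrak{T}$ is nonempty. Face transformations: (Merge) for a mid-branch space in any tree (including $\mathfrak{T}$), replace the two branches by one branch carrying the leaves of both; (Push apart) for a mid-branch space in a tree of $\mathfrak{F}$ or $\mathfrak{G}$, split that tree into two consecutive trees there; (Move left) remove some positive number of leftmost branches of $\mathfrak{T}$ and add them as a new rightmost tree of $\mathfrak{F}$;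 (Move right) remove some positive number of rightmost branches of $\mathfrak{T}$ and add them as a new leftmost tree of $\mathfrak{G}$. Known labelling (from earlier work): the faces of the freehedron $\mathcal{F}^n$ (a subdivision of the cube $[0,2]^n$) are in bijection with forest-tree-forest triples with $n$ leaves, dimensions agree, and the face labelled $\sigma$ is contained in the face labelled $\tau$ iff $\sigma$ is obtained from $\tau$ by a finite (possibly empty) sequence of face transformations. Vertices correspond to triples of dimension $0$ (empty middle tree, every tree has one branch). For such a triple $(\mathfrak{F},\emptyset,\mathfrak{G})$, label the leaves right to left $L_1,\dots,L_n$; the vertex has coordinates $v_1=2$ if $\mathfrak{G}$ is nonempty and $v_1=0$ otherwise, and for $i>1$: $v_i=2$ if $L_{i-1},L_i$ are on the same tree, $v_i=1$ if they are on different trees of the right forest, $v_i=0$ if they are on different trees of the left forest or in different forests. -}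

module Defs where

open import Data.Nat using (ℕ; zero; suc; _+_; _∸_; _≡ᵇ_)
open import Data.Bool using (if_then_else_)
open import Data.Nat.ListAction using (sum)
open import Data.List using (List; []; _∷_; _++_; map; concat; concatMap; reverse; replicate; length)
import Data.List as L
open import Data.List.NonEmpty using (List⁺; _∷_; toList; [_]; foldr₁)
open import Data.Product using (_×_; _,_)
open import Relation.Binary.PropositionalEquality using (_≡_)

-- Planar rooted trees of depth 2 and forest-tree-forest triples.
-- A branch is represented by a natural number k; it carries (suc k)
-- leaves (every branch carries at least one leaf).

Branch : Set
Branch = ℕ

bLeaves : Branch → ℕ
bLeaves k = suc k

-- the branch obtained by merging two neighbouring branches
-- (it carries the leaves of both: suc a + suc b = suc (a + suc b))
join : Branch → Branch → Branch
join a b = a + suc b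

Tree : Set
Tree = List⁺ Branch

MidTree : Set
MidTree = List Branch

Forest : Set
Forest = List Tree

record Triple : Set where
  constructor ⟨_,_,_⟩
  field
    F : Forest
    T : MidTree
    G : Forest
open Triple public

branchesLeaves : List Branch → ℕ
branchesLeaves bs = sum (map bLeaves bs)

forestLeaves : Forest → ℕ
forestLeaves f = sum (map (λ t → branchesLeaves (toList t)) f)

leaves : Triple → ℕ
leaves ⟨ f , t , g ⟩ = forestLeaves f + branchesLeaves t + forestLeaves g

spaces : List Branch → ℕ
spaces bs = length bs ∸ 1

forestSpaces : Forest → ℕ
forestSpaces f = sum (map (λ t → spaces (toList t)) f)

midOne : MidTree → ℕ
midOne []      = 0
midOne (_ ∷ _) = 1

dim : Triple → ℕ
dim ⟨ f , t , g ⟩ = forestSpaces f + spaces t + midOne t + forestSpaces g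

IsVertex : Triple → Set
IsVertex τ = dim τ ≡ 0

data MergeL : List Branch → List Branch → Set where
  here  : ∀ {a b ys} → MergeL (a ∷ b ∷ ys) (join a b ∷ ys)
  there : ∀ {x xs ys} → MergeL xs ys → MergeL (x ∷ xs) (x ∷ ys)

data MergeF : Forest → Forest → Set where
  here  : ∀ {t t' f} → MergeL (toList t) (toList t') → MergeF (t ∷ f) (t' ∷ f)
  there : ∀ {t f f'} → MergeF f f' → MergeF (t ∷ f) (t ∷ f')

data PushF : Forest → Forest → Set where
  here  : ∀ {t t₁ t₂ f} → toList t ≡ toList t₁ ++ toList t₂ →
          PushF (t ∷ f) (t₁ ∷ t₂ ∷ f)
  there : ∀ {t f f'} → PushF f f' → PushF (t ∷ f) (t ∷ f')

data Step : Triple → Triple → Set where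
  mergeF : ∀ {f f' t g} → MergeF f f' → Step ⟨ f , t , g ⟩ ⟨ f' , t , g ⟩
  mergeT : ∀ {f t t' g} → MergeL t t' → Step ⟨ f , t , g ⟩ ⟨ f , t' , g ⟩
  mergeG : ∀ {f t g g'} → MergeF g g' → Step ⟨ f , t , g ⟩ ⟨ f , t , g' ⟩
  pushF  : ∀ {f f' t g} → PushF f f' → Step ⟨ f , t , g ⟩ ⟨ f' , t , g ⟩
  pushG  : ∀ {f t g g'} → PushF g g' → Step ⟨ f , t , g ⟩ ⟨ f , t , g' ⟩
  moveL  : ∀ {f t t' g} (p : List⁺ Branch) → t ≡ toList p ++ t' →
           Step ⟨ f , t , g ⟩ ⟨ f L.∷ʳ p , t' , g ⟩
  moveR  : ∀ {f t t' g} (p : List⁺ Branch) → t ≡ t' ++ toList p →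
           Step ⟨ f , t , g ⟩ ⟨ f , t' , p ∷ g ⟩

data Side : Set where
  left middle right : Side

-- a leaf tag: which part of the triple, and index of the tree there
Tag : Set
Tag = Side × ℕ

forestTags : Side → ℕ → Forest → List Tag
forestTags s i []      = []
forestTags s i (t ∷ f) =
  replicate (branchesLeaves (toList t)) (s , i) ++ forestTags s (suc i) f

tags : Triple → List Tag
tags ⟨ f , t , g ⟩ =
  forestTags left 0 f ++ replicate (branchesLeaves t) (middle , 0)
                      ++ forestTags right 0 g

pairCoord : Tag → Tag → ℕ
pairCoord (left   , i) (left   , j) = if i ≡ᵇ j then 2 else 0
pairCoord (right  , i) (right  , j) = if i ≡ᵇ j then 2 else 1
pairCoord (middle , _) (middle , _) = 2
pairCoord _            _            = 0

pairCoords : List Tag → List ℕ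
pairCoords (x ∷ y ∷ r) = pairCoord x y ∷ pairCoords (y ∷ r)
pairCoords _           = []

firstCoord : Forest → ℕ
firstCoord []      = 0
firstCoord (_ ∷ _) = 2

-- coordinates (v₁, …, vₙ) of the vertex labelled by a dimension-0 triple;
-- leaves are labelled right to left L₁ … Lₙ, hence the reverse.
coords : Triple → List ℕ
coords τ = firstCoord (G τ) ∷ pairCoords (reverse (tags τ))

moveAllLeft : Triple → Triple
moveAllLeft ⟨ f , []     , g ⟩ = ⟨ f , [] , g ⟩
moveAllLeft ⟨ f , b ∷ bs , g ⟩ = ⟨ f L.∷ʳ (b ∷ bs) , [] , g ⟩

moveAllRight : Triple → Triple
moveAllRight ⟨ f , []     , g ⟩ = ⟨ f , [] , g ⟩
moveAllRight ⟨ f , b ∷ bs , g ⟩ = ⟨ f , [] , (b ∷ bs) ∷ g ⟩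

-- (after moveAllLeft / moveAllRight the middle tree is empty)
-- push apart at all mid-branch spaces of a forest
pushAllF : Forest → Forest
pushAllF f = concatMap (λ t → map [_] (toList t)) f

mergeAllF : Forest → Forest
mergeAllF f = map (λ t → [ foldr₁ join t ]) f

pushAll : Triple → Triple
pushAll ⟨ f , t , g ⟩ = ⟨ pushAllF f , t , pushAllF g ⟩

mergeAll : Triple → Triple
mergeAll ⟨ f , t , g ⟩ = ⟨ mergeAllF f , t , mergeAllF g ⟩

Vmin : Triple → Triple
Vmin τ = pushAll (moveAllLeft τ)

Vmax : Triple → Triple
Vmax τ = mergeAll (moveAllRight τ)

{-# OPTIONS --safe #-}
module Submission where

-- A vertex is encoded by v₁ followed by its other coordinates in reverse
-- order.  To a face τ we attach two such codes: minCode τ, the code of the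
-- vertex obtained by pushing every branch apart and sending the middle
-- branches to the left, and maxCode τ, obtained by merging every tree into
-- a single branch and sending the middle tree to the right.  A face
-- transformation can only raise minCode and lower maxCode: merging turns a
-- separator into a 2, pushing apart leaves the row of branches unchanged,
-- and moving turns separators 0 between left trees into separators 1
-- between right trees.  On a vertex both codes are its own code, and
-- Vmin τ, Vmax τ are faces of τ with the same codes as τ, whence their
-- extremality.

open import Defs
open import Data.Nat using (ℕ; _≤_; _≥_)
open import Data.Product using (_×_)
open import Data.List.Relation.Binary.Pointwise using (Pointwise)
open import Relation.Binary.Construct.Closure.ReflexiveTransitive using (Star)
open import Relation.Binary.PropositionalEquality using (_≡_)

open import Data.Bool using (true; false; if_then_else_)
open import Data.Empty using (⊥-elim)
open import Relation.Nullary using (¬_)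
open import Data.Nat using (zero; suc; _+_; _≡ᵇ_; z≤n; s≤s)
open import Data.Nat.ListAction using (sum)
open import Data.Nat.ListAction.Properties using (sum-++)
open import Data.Nat.Properties
  using (≤-refl; ≤-trans; ≤-reflexive; +-assoc; +-identityʳ; suc-injective; m+n≡0⇒m≡0; m+n≡0⇒n≡0)
open import Data.Product using (_,_)
open import Data.List using (List; []; _∷_; _++_; _∷ʳ_; map; concatMap; replicate; reverse; reverseAcc; drop)
open import Data.List.Properties using (++-assoc; ++-identityʳ; map-++; concatMap-++; unfold-reverse)
open import Data.List.NonEmpty using (_∷_; toList; [_]; foldr₁)
open import Data.List.Relation.Binary.Pointwise using ([]; _∷_; ++⁺ˡ; reverse⁺)
import Data.List.Relation.Binary.Pointwise as Pointwise
open import Function using (id)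
open import Relation.Binary.Construct.Closure.ReflexiveTransitive using (ε; _◅_; _◅◅_; gmap; fold)
open import Relation.Binary.PropositionalEquality
  using (refl; sym; trans; cong; cong₂; subst; subst₂; module ≡-Reasoning)

≡ᵇ-refl : ∀ n → (n ≡ᵇ n) ≡ true
≡ᵇ-refl zero    = refl
≡ᵇ-refl (suc n) = ≡ᵇ-refl n

≡ᵇ-suc : ∀ n → (n ≡ᵇ suc n) ≡ false
≡ᵇ-suc zero    = refl
≡ᵇ-suc (suc n) = ≡ᵇ-suc n

≡ᵇ-comm : ∀ m n → (m ≡ᵇ n) ≡ (n ≡ᵇ m)
≡ᵇ-comm zero    zero    = refl
≡ᵇ-comm zero    (suc n) = refl
≡ᵇ-comm (suc m) zero    = refl
≡ᵇ-comm (suc m) (suc n) = ≡ᵇ-comm m n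

pairCoord-self : ∀ x → pairCoord x x ≡ 2
pairCoord-self (left   , i) rewrite ≡ᵇ-refl i = refl
pairCoord-self (middle , i) = refl
pairCoord-self (right  , i) rewrite ≡ᵇ-refl i = refl

pairCoord-comm : ∀ x y → pairCoord x y ≡ pairCoord y x
pairCoord-comm (left   , i) (left   , j) = cong (if_then 2 else 0) (≡ᵇ-comm i j)
pairCoord-comm (right  , i) (right  , j) = cong (if_then 2 else 1) (≡ᵇ-comm i j)
pairCoord-comm (middle , _) (middle , _) = refl
pairCoord-comm (left   , _) (middle , _) = refl
pairCoord-comm (left   , _) (right  , _) = refl
pairCoord-comm (middle , _) (left   , _) = refl
pairCoord-comm (middle , _) (right  , _) = refl
pairCoord-comm (right  , _) (left   , _) = refl
pairCoord-comm (right  , _) (middle , _) = refl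

pairCoord-left-suc : ∀ j → pairCoord (left , j) (left , suc j) ≡ 0
pairCoord-left-suc j rewrite ≡ᵇ-suc j = refl

pairCoord-right-suc : ∀ j → pairCoord (right , j) (right , suc j) ≡ 1
pairCoord-right-suc j rewrite ≡ᵇ-suc j = refl

pairCoords-reverseAcc : ∀ x acc r →
  pairCoords (reverseAcc (x ∷ acc) r) ≡ reverse (pairCoords (x ∷ r)) ++ pairCoords (x ∷ acc)
pairCoords-reverseAcc x acc []      = refl
pairCoords-reverseAcc x acc (y ∷ r) = begin
  pairCoords (reverseAcc (y ∷ x ∷ acc) r)
    ≡⟨ pairCoords-reverseAcc y (x ∷ acc) r ⟩
  reverse cs ++ pairCoord y x ∷ pairCoords (x ∷ acc)
    ≡⟨ cong (λ c → reverse cs ++ c ∷ pairCoords (x ∷ acc)) (pairCoord-comm y x) ⟩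
  reverse cs ++ pairCoord x y ∷ pairCoords (x ∷ acc)
    ≡⟨ ++-assoc (reverse cs) (pairCoord x y ∷ []) (pairCoords (x ∷ acc)) ⟨
  (reverse cs ∷ʳ pairCoord x y) ++ pairCoords (x ∷ acc)
    ≡⟨ cong (_++ pairCoords (x ∷ acc)) (unfold-reverse (pairCoord x y) cs) ⟨
  reverse (pairCoords (x ∷ y ∷ r)) ++ pairCoords (x ∷ acc) ∎
  where
  open ≡-Reasoning
  cs = pairCoords (y ∷ r)

pairCoords-reverse : ∀ xs → pairCoords (reverse xs) ≡ reverse (pairCoords xs)
pairCoords-reverse []      = refl
pairCoords-reverse (x ∷ r) = trans (pairCoords-reverseAcc x [] r) (++-identityʳ _)

pairCoords-drop : ∀ p xs → pairCoords xs ≡ drop 1 (pairCoords (p ∷ xs))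
pairCoords-drop p []      = refl
pairCoords-drop p (x ∷ r) = refl

twos : ℕ → List ℕ
twos k = replicate k 2

-- A row of blocks of k + 1 leaves, read left to right: 2 inside a block,
-- separator c in front of the first block and d in front of the others.
blocks : ℕ → ℕ → List Branch → List ℕ → List ℕ
blocks c d []       r = r
blocks c d (k ∷ ks) r = c ∷ twos k ++ blocks d d ks r

pairCoords-replicate : ∀ p x k xs →
  pairCoords (p ∷ replicate (suc k) x ++ xs) ≡ pairCoord p x ∷ twos k ++ pairCoords (x ∷ xs)
pairCoords-replicate p x zero    xs = refl
pairCoords-replicate p x (suc k) xs =
  cong (pairCoord p x ∷_)
       (trans (pairCoords-replicate x x k xs) (cong (_∷ twos k ++ pairCoords (x ∷ xs)) (pairCoord-self x)))

blocks-++ : ∀ d xs ys r → blocks d d (xs ++ ys) r ≡ blocks d d xs (blocks d d ys r)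
blocks-++ d []       ys r = refl
blocks-++ d (x ∷ xs) ys r = cong (λ cs → d ∷ twos x ++ cs) (blocks-++ d xs ys r)

infix 4 _≼_

_≼_ : List ℕ → List ℕ → Set
_≼_ = Pointwise _≤_

≼-refl : ∀ {xs} → xs ≼ xs
≼-refl = Pointwise.refl ≤-refl

≼-trans : ∀ {xs ys zs} → xs ≼ ys → ys ≼ zs → xs ≼ zs
≼-trans = Pointwise.transitive ≤-trans

drop⁺ : ∀ n {xs ys} → xs ≼ ys → drop n xs ≼ drop n ys
drop⁺ zero    p       = p
drop⁺ (suc n) []      = []
drop⁺ (suc n) (_ ∷ p) = drop⁺ n p

twos-split : ∀ a b {c} r → c ≤ 2 → twos a ++ c ∷ twos b ++ r ≼ twos (join a b) ++ r
twos-split zero    b r c≤2 = c≤2 ∷ ≼-refl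
twos-split (suc a) b r c≤2 = ≤-refl ∷ twos-split a b r c≤2

blocks-mono : ∀ {c c′ r r′} d ks → c ≤ c′ → r ≼ r′ → blocks c d ks r ≼ blocks c′ d ks r′
blocks-mono d []       c≤c′ r≼r′ = r≼r′
blocks-mono d (k ∷ ks) c≤c′ r≼r′ = c≤c′ ∷ ++⁺ˡ ≤-refl (twos k) (blocks-mono d ks ≤-refl r≼r′)

blocks-merge : ∀ {c d xs ys} r → d ≤ 2 → MergeL xs ys → blocks c d xs r ≼ blocks c d ys r
blocks-merge r d≤2 (here {a} {b}) = ≤-refl ∷ twos-split a b _ d≤2
blocks-merge r d≤2 (there {x} m)  = ≤-refl ∷ ++⁺ˡ ≤-refl (twos x) (blocks-merge r d≤2 m)

-- Turning left trees into right trees only raises separators from 0 to 1.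
blocks-leftToRight : ∀ {c} ps ms r → blocks 0 0 ps (blocks 0 1 ms r) ≼ blocks c 1 (ps ++ ms) r
blocks-leftToRight []       ms r = blocks-mono 1 ms z≤n ≼-refl
blocks-leftToRight (p ∷ ps) ms r = z≤n ∷ ++⁺ˡ ≤-refl (twos p) (blocks-leftToRight ps ms r)

firstEntry : List Branch → ℕ
firstEntry []      = 0
firstEntry (_ ∷ _) = 2

firstEntry≤2 : ∀ ms → firstEntry ms ≤ 2
firstEntry≤2 []      = z≤n
firstEntry≤2 (_ ∷ _) = ≤-refl

firstEntry-merge : ∀ {xs ys} → MergeL xs ys → firstEntry xs ≡ firstEntry ys
firstEntry-merge here      = refl
firstEntry-merge (there _) = refl

-- v₁ followed by the pair coordinates read left to right, starting with a
-- spurious separator 0 in front of the first leaf; ks and ms are the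
-- single branches of the left and the right trees.
vertexCode : List Branch → List Branch → List ℕ
vertexCode ks ms = firstEntry ms ∷ blocks 0 0 ks (blocks 0 1 ms [])

toCoords : List ℕ → List ℕ
toCoords []       = []
toCoords (c ∷ cs) = c ∷ reverse (drop 1 cs)

toCoords-mono : ∀ {xs ys} → xs ≼ ys → toCoords xs ≼ toCoords ys
toCoords-mono []      = []
toCoords-mono (c ∷ p) = c ∷ reverse⁺ (drop⁺ 1 p)

vertexCode-mergeˡ : ∀ {ks ks′} ms → MergeL ks ks′ → vertexCode ks ms ≼ vertexCode ks′ ms
vertexCode-mergeˡ ms m = ≤-refl ∷ blocks-merge _ z≤n m

vertexCode-mergeʳ : ∀ ks {ms ms′} → MergeL ms ms′ → vertexCode ks ms ≼ vertexCode ks ms′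
vertexCode-mergeʳ ks m =
  ≤-reflexive (firstEntry-merge m) ∷ blocks-mono 0 ks ≤-refl (blocks-merge [] (s≤s z≤n) m)

vertexCode-moveʳ : ∀ ks p ps ms → vertexCode (ks ++ p ∷ ps) ms ≼ vertexCode ks (p ∷ ps ++ ms)
vertexCode-moveʳ ks p ps ms rewrite blocks-++ 0 ks (p ∷ ps) (blocks 0 1 ms []) =
  firstEntry≤2 ms ∷ blocks-mono 0 ks ≤-refl (≤-refl ∷ ++⁺ˡ ≤-refl (twos p) (blocks-leftToRight ps ms []))

mergedBranch : Tree → Branch
mergedBranch = foldr₁ join

branches : Forest → List Branch
branches = concatMap toList

branchesLeaves-++ : ∀ xs ys → branchesLeaves (xs ++ ys) ≡ branchesLeaves xs + branchesLeaves ys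
branchesLeaves-++ xs ys = trans (cong sum (map-++ bLeaves xs ys)) (sum-++ (map bLeaves xs) (map bLeaves ys))

branchesLeaves-merge : ∀ {xs ys} → MergeL xs ys → branchesLeaves xs ≡ branchesLeaves ys
branchesLeaves-merge (here {a} {b} {ys}) = cong suc (sym (+-assoc a (suc b) (branchesLeaves ys)))
branchesLeaves-merge (there {x} m)       = cong (suc x +_) (branchesLeaves-merge m)

leaves-mergedBranch : ∀ t → branchesLeaves (toList t) ≡ bLeaves (mergedBranch t)
leaves-mergedBranch (x ∷ xs) = go x xs
  where
  go : ∀ x xs → branchesLeaves (x ∷ xs) ≡ bLeaves (mergedBranch (x ∷ xs))
  go x []       = cong suc (+-identityʳ x)
  go x (y ∷ ys) = cong (suc x +_) (go y ys)

mergedBranch-merge : ∀ {t u} → MergeL (toList t) (toList u) → mergedBranch t ≡ mergedBranch u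
mergedBranch-merge {t} {u} m = suc-injective (begin
  bLeaves (mergedBranch t)  ≡⟨ leaves-mergedBranch t ⟨
  branchesLeaves (toList t) ≡⟨ branchesLeaves-merge m ⟩
  branchesLeaves (toList u) ≡⟨ leaves-mergedBranch u ⟩
  bLeaves (mergedBranch u)  ∎)
  where open ≡-Reasoning

mergedBranch-split : ∀ {t t₁ t₂} → toList t ≡ toList t₁ ++ toList t₂ →
                     mergedBranch t ≡ join (mergedBranch t₁) (mergedBranch t₂)
mergedBranch-split {t} {t₁} {t₂} eq = suc-injective (begin
  bLeaves (mergedBranch t)                              ≡⟨ leaves-mergedBranch t ⟨
  branchesLeaves (toList t)                             ≡⟨ cong branchesLeaves eq ⟩
  branchesLeaves (toList t₁ ++ toList t₂)               ≡⟨ branchesLeaves-++ (toList t₁) (toList t₂) ⟩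
  branchesLeaves (toList t₁) + branchesLeaves (toList t₂)
    ≡⟨ cong₂ _+_ (leaves-mergedBranch t₁) (leaves-mergedBranch t₂) ⟩
  bLeaves (join (mergedBranch t₁) (mergedBranch t₂))    ∎)
  where open ≡-Reasoning

MergeL-++ʳ : ∀ {xs ys} zs → MergeL xs ys → MergeL (xs ++ zs) (ys ++ zs)
MergeL-++ʳ zs here      = here
MergeL-++ʳ zs (there m) = there (MergeL-++ʳ zs m)

MergeL-++ˡ : ∀ {xs ys} zs → MergeL xs ys → MergeL (zs ++ xs) (zs ++ ys)
MergeL-++ˡ []       m = m
MergeL-++ˡ (z ∷ zs) m = there (MergeL-++ˡ zs m)

branches-merge : ∀ {f f′} → MergeF f f′ → MergeL (branches f) (branches f′)
branches-merge {_ ∷ f} (here m)   = MergeL-++ʳ (branches f) m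
branches-merge (there {t} m)      = MergeL-++ˡ (toList t) (branches-merge m)

branches-push : ∀ {f f′} → PushF f f′ → branches f ≡ branches f′
branches-push {_ ∷ f} (here {t₁ = t₁} {t₂} eq) =
  trans (cong (_++ branches f) eq) (++-assoc (toList t₁) (toList t₂) (branches f))
branches-push (there {t} m) = cong (toList t ++_) (branches-push m)

branches-∷ʳ : ∀ f p → branches (f ∷ʳ p) ≡ branches f ++ toList p
branches-∷ʳ f p = trans (concatMap-++ toList f (p ∷ [])) (cong (branches f ++_) (++-identityʳ (toList p)))

branches-singletons : ∀ ks → branches (map [_] ks) ≡ ks
branches-singletons []       = refl
branches-singletons (k ∷ ks) = cong (k ∷_) (branches-singletons ks)

branches-pushAll : ∀ f → branches (pushAllF f) ≡ branches f
branches-pushAll []      = refl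
branches-pushAll (t ∷ f) =
  trans (concatMap-++ toList (map [_] (toList t)) (pushAllF f))
        (cong₂ _++_ (branches-singletons (toList t)) (branches-pushAll f))

branches-flat : ∀ f → forestSpaces f ≡ 0 → branches f ≡ map mergedBranch f
branches-flat []                  _ = refl
branches-flat ((x ∷ []) ∷ f)      e = cong (x ∷_) (branches-flat f e)
branches-flat ((x ∷ _ ∷ _) ∷ f) ()

mergedBranches-merge : ∀ {f f′} → MergeF f f′ → map mergedBranch f ≡ map mergedBranch f′
mergedBranches-merge {_ ∷ f} (here m) = cong (_∷ map mergedBranch f) (mergedBranch-merge m)
mergedBranches-merge (there {t} m)    = cong (mergedBranch t ∷_) (mergedBranches-merge m)

mergedBranches-push : ∀ {f f′} → PushF f f′ → MergeL (map mergedBranch f′) (map mergedBranch f)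
mergedBranches-push {_ ∷ f} (here {t₁ = t₁} {t₂} eq) =
  subst (λ b → MergeL (mergedBranch t₁ ∷ mergedBranch t₂ ∷ map mergedBranch f) (b ∷ map mergedBranch f))
        (sym (mergedBranch-split eq)) here
mergedBranches-push (there m) = there (mergedBranches-push m)

mergedBranches-mergeAll : ∀ f → map mergedBranch (mergeAllF f) ≡ map mergedBranch f
mergedBranches-mergeAll []      = refl
mergedBranches-mergeAll (t ∷ f) = cong (mergedBranch t ∷_) (mergedBranches-mergeAll f)

forestTags-pairCoords : ∀ {s d rest R} → (∀ j → pairCoord (s , j) (s , suc j) ≡ d) →
  (∀ j → pairCoords ((s , j) ∷ rest) ≡ R) →
  ∀ p i f → pairCoords (p ∷ rest) ≡ R →
  pairCoords (p ∷ forestTags s i f ++ rest) ≡ blocks (pairCoord p (s , i)) d (map mergedBranch f) R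
forestTags-pairCoords next cont p i []      start = start
forestTags-pairCoords {s} {d} {rest} {R} next cont p i (t ∷ f) _ = begin
  pairCoords (p ∷ (replicate (branchesLeaves (toList t)) (s , i) ++ tags′) ++ rest)
    ≡⟨ cong (λ xs → pairCoords (p ∷ xs))
            (++-assoc (replicate (branchesLeaves (toList t)) (s , i)) tags′ rest) ⟩
  pairCoords (p ∷ replicate (branchesLeaves (toList t)) (s , i) ++ tags′ ++ rest)
    ≡⟨ cong (λ n → pairCoords (p ∷ replicate n (s , i) ++ tags′ ++ rest)) (leaves-mergedBranch t) ⟩
  pairCoords (p ∷ replicate (bLeaves (mergedBranch t)) (s , i) ++ tags′ ++ rest)
    ≡⟨ pairCoords-replicate p (s , i) (mergedBranch t) (tags′ ++ rest) ⟩
  pairCoord p (s , i) ∷ twos (mergedBranch t) ++ pairCoords ((s , i) ∷ tags′ ++ rest)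
    ≡⟨ cong (λ cs → pairCoord p (s , i) ∷ twos (mergedBranch t) ++ cs)
            (forestTags-pairCoords next cont (s , i) (suc i) f (cont i)) ⟩
  pairCoord p (s , i) ∷ twos (mergedBranch t) ++
    blocks (pairCoord (s , i) (s , suc i)) d (map mergedBranch f) R
    ≡⟨ cong (λ c → pairCoord p (s , i) ∷ twos (mergedBranch t) ++ blocks c d (map mergedBranch f) R)
            (next i) ⟩
  blocks (pairCoord p (s , i)) d (map mergedBranch (t ∷ f)) R ∎
  where
  open ≡-Reasoning
  tags′ = forestTags s (suc i) f

pairCoords-tags : ∀ f g →
  pairCoords ((middle , 0) ∷ tags ⟨ f , [] , g ⟩) ≡
  blocks 0 0 (map mergedBranch f) (blocks 0 1 (map mergedBranch g) [])
pairCoords-tags f g =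
  forestTags-pairCoords pairCoord-left-suc (λ j → rightTags (left , j) refl) (middle , 0) 0 f
                        (rightTags (middle , 0) refl)
  where
  open ≡-Reasoning
  rightTags : ∀ p → pairCoord p (right , 0) ≡ 0 →
              pairCoords (p ∷ forestTags right 0 g) ≡ blocks 0 1 (map mergedBranch g) []
  rightTags p e = begin
    pairCoords (p ∷ forestTags right 0 g)
      ≡⟨ cong (λ xs → pairCoords (p ∷ xs)) (++-identityʳ (forestTags right 0 g)) ⟨
    pairCoords (p ∷ forestTags right 0 g ++ [])
      ≡⟨ forestTags-pairCoords pairCoord-right-suc (λ _ → refl) p 0 g refl ⟩
    blocks (pairCoord p (right , 0)) 1 (map mergedBranch g) []
      ≡⟨ cong (λ c → blocks c 1 (map mergedBranch g) []) e ⟩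
    blocks 0 1 (map mergedBranch g) [] ∎

firstCoord-mergedBranches : ∀ g → firstCoord g ≡ firstEntry (map mergedBranch g)
firstCoord-mergedBranches []      = refl
firstCoord-mergedBranches (_ ∷ _) = refl

coords-emptyMid : ∀ f g →
  coords ⟨ f , [] , g ⟩ ≡ toCoords (vertexCode (map mergedBranch f) (map mergedBranch g))
coords-emptyMid f g = cong₂ _∷_ (firstCoord-mergedBranches g) (begin
  pairCoords (reverse xs)
    ≡⟨ pairCoords-reverse xs ⟩
  reverse (pairCoords xs)
    ≡⟨ cong reverse (pairCoords-drop (middle , 0) xs) ⟩
  reverse (drop 1 (pairCoords ((middle , 0) ∷ xs)))
    ≡⟨ cong (λ cs → reverse (drop 1 cs)) (pairCoords-tags f g) ⟩
  reverse (drop 1 (blocks 0 0 (map mergedBranch f) (blocks 0 1 (map mergedBranch g) []))) ∎)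
  where
  open ≡-Reasoning
  xs = tags ⟨ f , [] , g ⟩

infixr 5 _◂_

_◂_ : MidTree → Forest → Forest
[]       ◂ g = g
(b ∷ bs) ◂ g = (b ∷ bs) ∷ g

minCode : Triple → List ℕ
minCode ⟨ f , t , g ⟩ = vertexCode (branches f ++ t) (branches g)

maxCode : Triple → List ℕ
maxCode ⟨ f , t , g ⟩ = vertexCode (map mergedBranch f) (map mergedBranch (t ◂ g))

◂-merge : ∀ {t t′} g → MergeL t t′ → map mergedBranch (t ◂ g) ≡ map mergedBranch (t′ ◂ g)
◂-merge g m@here      = cong (_∷ map mergedBranch g) (mergedBranch-merge m)
◂-merge g m@(there _) = cong (_∷ map mergedBranch g) (mergedBranch-merge m)

◂-cong : ∀ t {g g′} → map mergedBranch g ≡ map mergedBranch g′ →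
         map mergedBranch (t ◂ g) ≡ map mergedBranch (t ◂ g′)
◂-cong []      e = e
◂-cong (_ ∷ _) e = cong (_ ∷_) e

◂-MergeL : ∀ t {g g′} → MergeL (map mergedBranch g) (map mergedBranch g′) →
           MergeL (map mergedBranch (t ◂ g)) (map mergedBranch (t ◂ g′))
◂-MergeL []      m = m
◂-MergeL (_ ∷ _) m = there m

minCode-step : ∀ {σ σ′} → Step σ σ′ → minCode σ ≼ minCode σ′
minCode-step {⟨ f , t , g ⟩} (mergeF m) = vertexCode-mergeˡ (branches g) (MergeL-++ʳ t (branches-merge m))
minCode-step {⟨ f , t , g ⟩} (mergeT m) = vertexCode-mergeˡ (branches g) (MergeL-++ˡ (branches f) m)
minCode-step {⟨ f , t , g ⟩} (mergeG m) = vertexCode-mergeʳ (branches f ++ t) (branches-merge m)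
minCode-step (pushF m) rewrite branches-push m = ≼-refl
minCode-step (pushG m) rewrite branches-push m = ≼-refl
minCode-step {⟨ f , _ , g ⟩} (moveL {t' = t′} p refl)
  rewrite branches-∷ʳ f p | ++-assoc (branches f) (toList p) t′ = ≼-refl
minCode-step {⟨ f , _ , g ⟩} (moveR {t' = t′} (p ∷ ps) refl)
  rewrite sym (++-assoc (branches f) t′ (p ∷ ps)) = vertexCode-moveʳ (branches f ++ t′) p ps (branches g)

maxCode-moveL : ∀ f p t g → maxCode ⟨ f ∷ʳ p , t , g ⟩ ≼ maxCode ⟨ f , toList p ++ t , g ⟩
maxCode-moveL f (p ∷ ps) [] g
  rewrite map-++ mergedBranch f ((p ∷ ps) ∷ []) | ++-identityʳ ps =
  vertexCode-moveʳ (map mergedBranch f) (mergedBranch (p ∷ ps)) [] (map mergedBranch g)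
maxCode-moveL f (p ∷ ps) (q ∷ qs) g
  rewrite map-++ mergedBranch f ((p ∷ ps) ∷ [])
        | mergedBranch-split {p ∷ (ps ++ q ∷ qs)} {p ∷ ps} {q ∷ qs} refl =
  ≼-trans (vertexCode-moveʳ (map mergedBranch f) (mergedBranch (p ∷ ps)) []
                            (map mergedBranch ((q ∷ qs) ∷ g)))
          (vertexCode-mergeʳ (map mergedBranch f) here)

maxCode-step : ∀ {σ σ′} → Step σ σ′ → maxCode σ′ ≼ maxCode σ
maxCode-step (mergeF m) rewrite mergedBranches-merge m = ≼-refl
maxCode-step {⟨ f , t , g ⟩} (mergeT m) rewrite ◂-merge g m = ≼-refl
maxCode-step {⟨ f , t , g ⟩} (mergeG m) rewrite ◂-cong t (mergedBranches-merge m) = ≼-refl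
maxCode-step {⟨ f , t , g ⟩} (pushF m) = vertexCode-mergeˡ _ (mergedBranches-push m)
maxCode-step {⟨ f , t , g ⟩} (pushG m) =
  vertexCode-mergeʳ (map mergedBranch f) (◂-MergeL t (mergedBranches-push m))
maxCode-step {⟨ f , _ , g ⟩} (moveL {t' = t′} p refl) = maxCode-moveL f p t′ g
maxCode-step (moveR {t' = []} p refl) = ≼-refl
maxCode-step {⟨ f , _ , g ⟩} (moveR {t' = q ∷ qs} (p ∷ ps) refl)
  rewrite mergedBranch-split {q ∷ (qs ++ p ∷ ps)} {q ∷ qs} {p ∷ ps} refl =
  vertexCode-mergeʳ (map mergedBranch f) here

mutual
  pushApart : ∀ f → Star PushF f (pushAllF f)
  pushApart []             = ε
  pushApart ((b ∷ bs) ∷ f) = pushApartTree b bs f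

  pushApartTree : ∀ b bs f → Star PushF ((b ∷ bs) ∷ f) (pushAllF ((b ∷ bs) ∷ f))
  pushApartTree b []       f = gmap ([ b ] ∷_) there (pushApart f)
  pushApartTree b (c ∷ bs) f = here refl ◅ gmap ([ b ] ∷_) there (pushApartTree c bs f)

mergeTree : ∀ b bs →
  Star (λ t t′ → MergeL (toList t) (toList t′)) (b ∷ bs) [ mergedBranch (b ∷ bs) ]
mergeTree b []       = ε
mergeTree b (c ∷ bs) = gmap (λ t → b ∷ toList t) there (mergeTree c bs) ◅◅ (here ◅ ε)

mergeTogether : ∀ f → Star MergeF f (mergeAllF f)
mergeTogether []             = ε
mergeTogether ((b ∷ bs) ∷ f) =
  gmap (_∷ f) here (mergeTree b bs) ◅◅ gmap ([ mergedBranch (b ∷ bs) ] ∷_) there (mergeTogether f)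

reach-pushAll : ∀ f t g → Star Step ⟨ f , t , g ⟩ (pushAll ⟨ f , t , g ⟩)
reach-pushAll f t g =
  gmap (λ f′ → ⟨ f′ , t , g ⟩) pushF (pushApart f) ◅◅
  gmap (λ g′ → ⟨ pushAllF f , t , g′ ⟩) pushG (pushApart g)

reach-mergeAll : ∀ f t g → Star Step ⟨ f , t , g ⟩ (mergeAll ⟨ f , t , g ⟩)
reach-mergeAll f t g =
  gmap (λ f′ → ⟨ f′ , t , g ⟩) mergeF (mergeTogether f) ◅◅
  gmap (λ g′ → ⟨ mergeAllF f , t , g′ ⟩) mergeG (mergeTogether g)

Vmin-reachable : ∀ τ → Star Step τ (Vmin τ)
Vmin-reachable ⟨ f , []     , g ⟩ = reach-pushAll f [] g
Vmin-reachable ⟨ f , b ∷ bs , g ⟩ = moveL (b ∷ bs) (sym (++-identityʳ (b ∷ bs))) ◅ reach-pushAll _ [] g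

Vmax-reachable : ∀ τ → Star Step τ (Vmax τ)
Vmax-reachable ⟨ f , []     , g ⟩ = reach-mergeAll f [] g
Vmax-reachable ⟨ f , b ∷ bs , g ⟩ = moveR (b ∷ bs) refl ◅ reach-mergeAll f [] _

forestSpaces-pushAll : ∀ f → forestSpaces (pushAllF f) ≡ 0
forestSpaces-pushAll []      = refl
forestSpaces-pushAll (t ∷ f) = go (toList t)
  where
  go : ∀ bs → forestSpaces (map [_] bs ++ pushAllF f) ≡ 0
  go []       = forestSpaces-pushAll f
  go (_ ∷ bs) = go bs

forestSpaces-mergeAll : ∀ f → forestSpaces (mergeAllF f) ≡ 0
forestSpaces-mergeAll []      = refl
forestSpaces-mergeAll (_ ∷ f) = forestSpaces-mergeAll f

Vmin-isVertex : ∀ τ → IsVertex (Vmin τ)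
Vmin-isVertex ⟨ f , []     , g ⟩ rewrite forestSpaces-pushAll f | forestSpaces-pushAll g = refl
Vmin-isVertex ⟨ f , b ∷ bs , g ⟩ rewrite forestSpaces-pushAll (f ∷ʳ (b ∷ bs)) | forestSpaces-pushAll g = refl

Vmax-isVertex : ∀ τ → IsVertex (Vmax τ)
Vmax-isVertex ⟨ f , []     , g ⟩ rewrite forestSpaces-mergeAll f | forestSpaces-mergeAll g = refl
Vmax-isVertex ⟨ f , b ∷ bs , g ⟩ rewrite forestSpaces-mergeAll f | forestSpaces-mergeAll ((b ∷ bs) ∷ g) = refl

minCode-Vmin : ∀ τ → minCode (Vmin τ) ≡ minCode τ
minCode-Vmin ⟨ f , []     , g ⟩ rewrite branches-pushAll f | branches-pushAll g = refl
minCode-Vmin ⟨ f , b ∷ bs , g ⟩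
  rewrite branches-pushAll (f ∷ʳ (b ∷ bs)) | branches-pushAll g
        | branches-∷ʳ f (b ∷ bs) | ++-identityʳ (branches f ++ b ∷ bs) = refl

maxCode-Vmax : ∀ τ → maxCode (Vmax τ) ≡ maxCode τ
maxCode-Vmax ⟨ f , []     , g ⟩ rewrite mergedBranches-mergeAll f | mergedBranches-mergeAll g = refl
maxCode-Vmax ⟨ f , b ∷ bs , g ⟩
  rewrite mergedBranches-mergeAll f | mergedBranches-mergeAll g = refl

nonemptyMid-¬vertex : ∀ f b bs g → ¬ IsVertex ⟨ f , b ∷ bs , g ⟩
nonemptyMid-¬vertex f b bs g e with m+n≡0⇒n≡0 (forestSpaces f + spaces (b ∷ bs)) (m+n≡0⇒m≡0 _ e)
... | ()

vertex-forestSpaces : ∀ f g → IsVertex ⟨ f , [] , g ⟩ → forestSpaces f ≡ 0 × forestSpaces g ≡ 0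
vertex-forestSpaces f g e =
  m+n≡0⇒m≡0 _ (m+n≡0⇒m≡0 _ (m+n≡0⇒m≡0 _ e)) , m+n≡0⇒n≡0 (forestSpaces f + 0 + 0) e

minCode≡maxCode : ∀ v → IsVertex v → minCode v ≡ maxCode v
minCode≡maxCode ⟨ f , [] , g ⟩ e =
  let f-flat , g-flat = vertex-forestSpaces f g e in
  cong₂ vertexCode (trans (++-identityʳ (branches f)) (branches-flat f f-flat)) (branches-flat g g-flat)
minCode≡maxCode ⟨ f , b ∷ bs , g ⟩ e = ⊥-elim (nonemptyMid-¬vertex f b bs g e)

coords-maxCode : ∀ v → IsVertex v → coords v ≡ toCoords (maxCode v)
coords-maxCode ⟨ f , []     , g ⟩ _ = coords-emptyMid f g
coords-maxCode ⟨ f , b ∷ bs , g ⟩ e = ⊥-elim (nonemptyMid-¬vertex f b bs g e)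

coords-minCode : ∀ v → IsVertex v → coords v ≡ toCoords (minCode v)
coords-minCode v e = trans (coords-maxCode v e) (cong toCoords (sym (minCode≡maxCode v e)))

Vmin-minimal : ∀ τ v → IsVertex v → Star Step τ v → coords (Vmin τ) ≼ coords v
Vmin-minimal τ v v-vertex τ→v =
  subst₂ _≼_ (sym (coords-minCode (Vmin τ) (Vmin-isVertex τ))) (sym (coords-minCode v v-vertex))
    (toCoords-mono (subst (_≼ minCode v) (sym (minCode-Vmin τ)) minCode-increases))
  where
  minCode-increases : minCode τ ≼ minCode v
  minCode-increases =
    fold (λ σ σ′ → minCode σ ≼ minCode σ′) (λ s → ≼-trans (minCode-step s)) ≼-refl τ→v

Vmax-maximal : ∀ τ v → IsVertex v → Star Step τ v → Pointwise _≥_ (coords (Vmax τ)) (coords v)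
Vmax-maximal τ v v-vertex τ→v =
  Pointwise.symmetric id
    (subst₂ _≼_ (sym (coords-maxCode v v-vertex)) (sym (coords-maxCode (Vmax τ) (Vmax-isVertex τ)))
      (toCoords-mono (subst (maxCode v ≼_) (sym (maxCode-Vmax τ)) maxCode-decreases)))
  where
  maxCode-decreases : maxCode v ≼ maxCode τ
  maxCode-decreases =
    fold (λ σ σ′ → maxCode σ′ ≼ maxCode σ) (λ s p → ≼-trans p (maxCode-step s)) ≼-refl τ→v

mainTheorem3 : (n : ℕ) → 1 ≤ n → (τ : Triple) → leaves τ ≡ n →
    (IsVertex (Vmin τ) × Star Step τ (Vmin τ) ×
      ((v : Triple) → IsVertex v → Star Step τ v →
        Pointwise _≤_ (coords (Vmin τ)) (coords v)))
    ×
    (IsVertex (Vmax τ) × Star Step τ (Vmax τ) ×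
      ((v : Triple) → IsVertex v → Star Step τ v →
        Pointwise _≥_ (coords (Vmax τ)) (coords v)))
mainTheorem3 _ _ τ _ =
  (Vmin-isVertex τ , Vmin-reachable τ , Vmin-minimal τ) ,
  (Vmax-isVertex τ , Vmax-reachable τ , Vmax-maximal τ)
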